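{- Let $G,H$ be graphs. There is a lax minion homomorphism $\mu'\colon\mathrm{pol}(G,H)\to\mathrm{pol}(\mathrm{mhom}(K_2,G),\mathrm{mhom}(K_2,H))$.
   Context: $\mathrm{pol}^{(n)}(G,H)$ is the set of graph homomorphisms $G^n\to H$ (categorical power), $\mathrm{pol}(G,H)$ the union over $n>0$, with minors $f^\pi(x_1,\dots,x_m)=f(x_{\pi(1)},\dots,x_{\pi(n)})$ for $\pi\colon[n]\to[m]$. $\mathrm{mhom}(K_2,G)$ is the poset of multihomomorphisms $K_2\to G$: pairs of nonempty sets $m(1),m(2)\subseteq V(G)$ with $m(1)\times m(2)\subseteq E(G)$, ordered by componentwise inclusion. For posets $P,Q$, $\mathrm{pol}^{(n)}(P,Q)$ is the set of monotone maps $P^n\to Q$ (componentwise order on $P^n$), with minors defined by the same formula, and such maps are ordered pointwise. A lax minion homomorphism $\lambda\colon\mathcal M\to\mathrm{pol}(P,Q)$ from a minion $\mathcal M$ is a family of maps $\lambda_n\colon\mathcal M^{(n)}\to\mathrm{pol}^{(n)}(P,Q)$ with $\lambda_m(f^\pi)\le\lambda_n(f)^\pi$ for all $f\in\mathcal M^{(n)}$ and $\pi\colon[n]\to[m]$. -}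

module Defs where

open import Level using (Level; 0ℓ) renaming (suc to lsuc)
open import Data.Nat using (ℕ; suc)
open import Data.Fin using (Fin)
open import Data.Product using (Σ; ∃; _×_; _,_; proj₁; proj₂)
open import Function using (_∘_; id)
open import Relation.Unary using (Pred; _⊆_)
open import Relation.Binary.Bundles using (Poset)
open import Relation.Binary.Structures using (IsPartialOrder; IsPreorder; IsEquivalence)

record Graph : Set₁ where
  field
    V   : Set
    E   : V → V → Set
    sym : ∀ {u v} → E u v → E v u
open Graph

record Pol (G H : Graph) (n : ℕ) : Set where
  field
    fun : (Fin n → V G) → V H
    hom : ∀ {x y : Fin n → V G} → (∀ i → E G (x i) (y i)) → E H (fun x) (fun y)
open Pol

minor : ∀ {G H n m} → Pol G H n → (Fin n → Fin m) → Pol G H m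
fun (minor f π) x = fun f (x ∘ π)
hom (minor f π) e = hom f (λ i → e (π i))

-- Multihomomorphisms K₂ → G: pairs of nonempty vertex sets m(1), m(2)
-- with m(1) × m(2) ⊆ E(G).
record MHom (G : Graph) : Set₁ where
  field
    m₁   : Pred (V G) 0ℓ
    m₂   : Pred (V G) 0ℓ
    ne₁  : ∃ m₁
    ne₂  : ∃ m₂
    edge : ∀ {u v} → m₁ u → m₂ v → E G u v
open MHom

record _≤ᴹ_ {G} (a b : MHom G) : Set where
  constructor _,_
  field
    ⊆₁ : m₁ a ⊆ m₁ b
    ⊆₂ : m₂ a ⊆ m₂ b

_≈ᴹ_ : ∀ {G} → MHom G → MHom G → Set
a ≈ᴹ b = (a ≤ᴹ b) × (b ≤ᴹ a)

private
  ≤ᴹ-refl : ∀ {G} {a : MHom G} → a ≤ᴹ a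
  ≤ᴹ-refl = id , id

  ≤ᴹ-trans : ∀ {G} {a b c : MHom G} → a ≤ᴹ b → b ≤ᴹ c → a ≤ᴹ c
  ≤ᴹ-trans (p , q) (r , s) = r ∘ p , s ∘ q

mhomK2 : Graph → Poset (lsuc 0ℓ) 0ℓ 0ℓ
mhomK2 G = record
  { Carrier = MHom G
  ; _≈_ = _≈ᴹ_
  ; _≤_ = _≤ᴹ_
  ; isPartialOrder = record
    { isPreorder = record
      { isEquivalence = record
        { refl  = ≤ᴹ-refl , ≤ᴹ-refl 
        ; sym   = λ (p , q) → q , p
        ; trans = λ (p , q) (r , s) → ≤ᴹ-trans p r , ≤ᴹ-trans s q
        }
      ; reflexive = proj₁
      ; trans = ≤ᴹ-trans 
      }
    ; antisym = _,_
    }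
  }

record MPol {c₁ ℓ₁ ℓ₂ c₂ ℓ₃ ℓ₄} (P : Poset c₁ ℓ₁ ℓ₂) (Q : Poset c₂ ℓ₃ ℓ₄) (n : ℕ)
       : Set (c₁ Level.⊔ ℓ₂ Level.⊔ c₂ Level.⊔ ℓ₄) where
  field
    mfun : (Fin n → Poset.Carrier P) → Poset.Carrier Q
    mono : ∀ {x y : Fin n → Poset.Carrier P} →
           (∀ i → Poset._≤_ P (x i) (y i)) → Poset._≤_ Q (mfun x) (mfun y)
open MPol

module _ {c₁ ℓ₁ ℓ₂ c₂ ℓ₃ ℓ₄} {P : Poset c₁ ℓ₁ ℓ₂} {Q : Poset c₂ ℓ₃ ℓ₄} where

  mminor : ∀ {n m} → MPol P Q n → (Fin n → Fin m) → MPol P Q m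
  mfun (mminor f π) x = mfun f (x ∘ π)
  mono (mminor f π) le = mono f (λ i → le (π i))

  _⊑_ : ∀ {n} → MPol P Q n → MPol P Q n → Set (c₁ Level.⊔ ℓ₄)
  f ⊑ g = ∀ x → Poset._≤_ Q (mfun f x) (mfun g x)

-- A lax minion homomorphism pol(G,H) → pol(P,Q); arities are positive
-- (arity suc n stands for n+1 ≥ 1).
record LaxMinionHom {c₂ ℓ₃ ℓ₄ c₃ ℓ₅ ℓ₆} (G H : Graph)
       (P : Poset c₂ ℓ₃ ℓ₄) (Q : Poset c₃ ℓ₅ ℓ₆)
       : Set (lsuc 0ℓ Level.⊔ c₂ Level.⊔ ℓ₄ Level.⊔ c₃ Level.⊔ ℓ₆) where
  field
    λₙ  : ∀ {n} → Pol G H (suc n) → MPol P Q (suc n)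
    lax : ∀ {n m} (f : Pol G H (suc n)) (π : Fin (suc n) → Fin (suc m)) →
          λₙ (minor f π) ⊑ mminor (λₙ f) π

{-# OPTIONS --safe #-}
module Submission where

-- μ'(f) sends a tuple of multihomomorphisms a₁,…,aₙ to the pair of images
-- f(∏ aᵢ(1)), f(∏ aᵢ(2)); it is a multihomomorphism because f is a graph
-- homomorphism, and monotone because images of products are. Laxness is only
-- an inclusion: a point x of ∏ⱼ aⱼ yields the point x ∘ π of ∏ᵢ a_{π(i)} with
-- the same value, but not conversely when π is not injective.

open import Level using (Level; _⊔_)
open import Data.Fin using (Fin)
open import Data.Product using (Σ; ∃; _×_; _,_; proj₁; proj₂)
open import Function using (_∘_)
open import Relation.Unary using (Pred; _⊆_)
open import Relation.Binary.PropositionalEquality using (_≡_; refl)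

open import Defs
open Graph
open Pol
open MHom
open MPol
open _≤ᴹ_

module _ {a b ℓ : Level} {A : Set a} {B : Set b} where

  image : ∀ {n} → ((Fin n → A) → B) → (Fin n → Pred A ℓ) → Pred B (a ⊔ b ⊔ ℓ)
  image f S y = Σ (_ → A) λ x → (∀ i → S i (x i)) × f x ≡ y

  image-nonempty : ∀ {n} (f : (Fin n → A) → B) {S : Fin n → Pred A ℓ} →
                   (∀ i → ∃ (S i)) → ∃ (image f S)
  image-nonempty f S≢∅ = f (proj₁ ∘ S≢∅) , proj₁ ∘ S≢∅ , proj₂ ∘ S≢∅ , refl

  image-mono : ∀ {n} (f : (Fin n → A) → B) {S T : Fin n → Pred A ℓ} →
               (∀ i → S i ⊆ T i) → image f S ⊆ image f T
  image-mono f S⊆T (x , x∈S , fx≡y) = x , (λ i → S⊆T i (x∈S i)) , fx≡y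

  image-minor : ∀ {n m} (f : (Fin n → A) → B) (π : Fin n → Fin m) {S : Fin m → Pred A ℓ} →
                image (f ∘ (_∘ π)) S ⊆ image f (S ∘ π)
  image-minor f π (x , x∈S , fx≡y) = x ∘ π , x∈S ∘ π , fx≡y

module _ {G H : Graph} where

  image-edge : ∀ {n ℓ} (f : Pol G H n) {S T : Fin n → Pred (V G) ℓ} →
               (∀ i {u v} → S i u → T i v → E G u v) →
               ∀ {u v} → image (fun f) S u → image (fun f) T v → E H u v
  image-edge f S×T⊆E (x , x∈S , refl) (y , y∈T , refl) = hom f (λ i → S×T⊆E i (x∈S i) (y∈T i))

  mhomImage : ∀ {n} → Pol G H n → (Fin n → MHom G) → MHom H
  mhomImage f a = record
    { m₁   = image (fun f) (m₁ ∘ a)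
    ; m₂   = image (fun f) (m₂ ∘ a)
    ; ne₁  = image-nonempty (fun f) (ne₁ ∘ a)
    ; ne₂  = image-nonempty (fun f) (ne₂ ∘ a)
    ; edge = image-edge f (λ i → edge (a i))
    }

  mhomImage-mono : ∀ {n} (f : Pol G H n) {a b : Fin n → MHom G} →
                   (∀ i → a i ≤ᴹ b i) → mhomImage f a ≤ᴹ mhomImage f b
  mhomImage-mono f a≤b = image-mono (fun f) (⊆₁ ∘ a≤b) , image-mono (fun f) (⊆₂ ∘ a≤b)

  mhomImage-minor : ∀ {n m} (f : Pol G H n) (π : Fin n → Fin m) (a : Fin m → MHom G) →
                    mhomImage (minor f π) a ≤ᴹ mhomImage f (a ∘ π)
  mhomImage-minor f π a = image-minor (fun f) π {m₁ ∘ a} , image-minor (fun f) π {m₂ ∘ a}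

  mhomImagePol : ∀ {n} → Pol G H n → MPol (mhomK2 G) (mhomK2 H) n
  mhomImagePol f = record { mfun = mhomImage f ; mono = mhomImage-mono f }

lemmaA2 : (G H : Graph) → LaxMinionHom G H (mhomK2 G) (mhomK2 H)
lemmaA2 G H = record { λₙ = mhomImagePol ; lax = mhomImage-minor }
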